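{- Let $h>0$ and $\alpha>0$ be integers and $\lambda\vdash h+\alpha$. Define $\phi_{\lambda,h,\alpha}$ on $\operatorname{SYT}_{h,\alpha-1}(\lambda)$ as follows. If $T\in\operatorname{SYT}_{h,\alpha}(\lambda)$, set $\phi_{\lambda,h,\alpha}(T):=T$. Otherwise let $p:=\min\{0\leq i\leq h-1: R_{T}(h+\alpha)\leq R_{T}(i+\alpha)\}$, and let $\phi_{\lambda,h,\alpha}(T)$ be the tableau of shape $\lambda$ in which, for $1\le m\le h+\alpha$, the number $m$ is placed in the box \[v_{\phi_{\lambda,h,\alpha}(T)}(m)=\begin{cases} v_{T}(m) & 1\leq m\leq\alpha-1,\\ v_{T}(m-1) & 1+\alpha\leq m\leq p+\alpha\ \text{or}\ p+2+\alpha\leq m\leq h+\alpha,\\ v_{T}(h+\alpha) & m=p+1+\alpha,\\ v_{T}(p+\alpha) & m=\alpha.\end{cases}\] Then $\phi_{\lambda,h,\alpha}(T)\in\operatorname{SYT}_{h,\alpha}(\lambda)$ for every $T\in\operatorname{SYT}_{h,\alpha-1}(\lambda)$.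
   Context: For a partition $\lambda\vdash k$, its diagram has boxes $(i,j)$, $1\le i\le\ell(\lambda)$, $1\le j\le\lambda_i$ (row $i$ from the top). $\operatorname{SYT}(\lambda)$ is the set of standard Young tableaux of shape $\lambda$ (bijective fillings with $1,\ldots,k$ increasing along rows and down columns). For a tableau $T$ and $1\le m\le k$, $R_T(m)$ and $C_T(m)$ are the row and column of the box containing $m$, and $v_T(m)=(R_T(m),C_T(m))$. For $0\le h\le k$ and $0\le\alpha\le k-h$, $\operatorname{SYT}_{h,\alpha}(\lambda)$ is the set of $T\in\operatorname{SYT}(\lambda)$ with $R_T(i+1+\alpha)>R_T(i+\alpha)$ for all $1\le i<h$. -}

module Defs where

open import Data.Nat using (ℕ; zero; suc; _+_; _∸_; _≤_; _<_; _<ᵇ_; _≤ᵇ_; _≡ᵇ_)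
open import Data.Bool using (Bool; true; false; if_then_else_)
open import Data.List using (List; []; _∷_; length; applyUpTo; map)
open import Data.Bool.ListAction using (and)
open import Data.Nat.ListAction using (sum)
open import Data.List.Relation.Unary.All using (All)
open import Data.List.Relation.Unary.Linked using (Linked)
open import Data.Product using (Σ; _×_; _,_; proj₁; proj₂; ∃)
open import Relation.Binary.PropositionalEquality using (_≡_)

-- A box (i , j) : row i (from the top), column j, both 1-based.
Box : Set
Box = ℕ × ℕ

_⊢_ : List ℕ → ℕ → Set
lam ⊢ k = Linked (λ a b → b ≤ a) lam × All (λ a → 1 ≤ a) lam × sum lam ≡ k

-- λ_i for 1 ≤ i ≤ ℓ(λ), and 0 otherwise.
rowLen : List ℕ → ℕ → ℕ
rowLen [] _ = 0
rowLen (x ∷ xs) zero = 0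
rowLen (x ∷ xs) (suc zero) = x
rowLen (x ∷ xs) (suc (suc i)) = rowLen xs (suc i)

InDiagram : List ℕ → Box → Set
InDiagram lam (i , j) = 1 ≤ i × i ≤ length lam × 1 ≤ j × j ≤ rowLen lam i

-- A tableau is encoded by its position map v_T : m ↦ box containing m
-- (only the values on 1 ≤ m ≤ k matter).
Tableau : Set
Tableau = ℕ → Box

InRange : ℕ → ℕ → Set
InRange k m = 1 ≤ m × m ≤ k

IsSYT : List ℕ → ℕ → Tableau → Set
IsSYT lam k v =
    (∀ m → InRange k m → InDiagram lam (v m))
  × (∀ m m' → InRange k m → InRange k m' → v m ≡ v m' → m ≡ m')
  × (∀ b → InDiagram lam b → Σ ℕ λ m → InRange k m × v m ≡ b)
  × (∀ m m' i j → InRange k m → InRange k m' →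
       v m ≡ (i , j) → v m' ≡ (i , suc j) → m < m')
  × (∀ m m' i j → InRange k m → InRange k m' →
       v m ≡ (i , j) → v m' ≡ (suc i , j) → m < m')

R : Tableau → ℕ → ℕ
R v m = proj₁ (v m)

SYT[_,_] : ℕ → ℕ → List ℕ → ℕ → Tableau → Set
SYT[ h , α ] lam k v =
  IsSYT lam k v × (∀ i → 1 ≤ i → i < h → R v (i + α) < R v (suc i + α))

condᵇ : ℕ → ℕ → Tableau → Bool
condᵇ h α v = and (map (λ i → R v (i + α) <ᵇ R v (suc i + α)) (applyUpTo suc (h ∸ 1)))

-- least i ≥ start among the next `fuel` values with f i = true (else start + fuel)
search : (ℕ → Bool) → ℕ → ℕ → ℕ
search f i zero = i
search f i (suc n) = if f i then i else search f (suc i) n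

pIdx : ℕ → ℕ → Tableau → ℕ
pIdx h α v = search (λ i → R v (h + α) ≤ᵇ R v (i + α)) 0 h

moved : ℕ → ℕ → Tableau → Tableau
moved h α v m =
  if m <ᵇ α then v m
  else if m ≡ᵇ α then v (p + α)
  else if m ≡ᵇ suc (p + α) then v (h + α)
  else v (m ∸ 1)
  where p = pIdx h α v

-- φ_{λ,h,α}(T)  (only depends on the shape through T)
φ : ℕ → ℕ → Tableau → Tableau
φ h α v = if condᵇ h α v then v else moved h α v

-- Along α, α+1, …, h+α-1 the rows of T strictly increase; T lies in SYT_{h,α} unless the
-- last entry k = h+α falls back to a row not below that of h+α-1. Then P = p+α is the first
-- entry of the run whose row is at least that of k, and φ is the cyclic shift that moves P
-- to position α and k to position P+1. The new run reads P, α, …, P-1, k, P+1, …, k-1,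
-- whose rows strictly increase by the choice of P. The relabelling is a bijection, and the
-- only pairs whose order it reverses are (n, P) with α ≤ n < P and (n, k) with P < n < k;
-- neither kind of pair can be adjacent in the diagram, so the result is again standard.
-- For (n, k) this is immediate from the rows; for (P-1, P) stacked in one column it needs
-- that k ends its row: the box to the right of P-1 then holds an entry strictly between
-- P and k, in a row above that of P.
module Submission where

open import Defs
open import Data.Nat using (ℕ; zero; suc; _+_; _∸_; _≤_; _<_; z≤n; s≤s; s<s; _<ᵇ_; _≤ᵇ_; _≡ᵇ_)
open import Data.Nat.Properties
open import Data.Bool using (Bool; true; false; if_then_else_; T)
open import Data.Bool.ListAction using (and)
open import Data.List using (List; []; _∷_)
open import Data.List.Relation.Unary.All using (All; []; _∷_)
open import Data.List.Relation.Unary.All.Properties using (applyUpTo⁺₁; applyUpTo⁻; map⁺; map⁻)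
open import Data.List.Relation.Unary.Linked using (Linked; []; [-]; _∷_)
open import Data.Product using (Σ; _×_; _,_; proj₁; proj₂)
open import Data.Sum using (_⊎_; inj₁; inj₂)
open import Function using (_∘_)
open import Relation.Binary.PropositionalEquality
open import Relation.Binary.Definitions using (tri<; tri≈; tri>)
open import Relation.Nullary using (¬_; yes; no; contradiction)
open import Relation.Nullary.Decidable using (dec-true; dec-false)

<ᵇ-true : ∀ {m n} → m < n → (m <ᵇ n) ≡ true
<ᵇ-true {m} {n} = dec-true (m <? n)

<ᵇ-false : ∀ {m n} → ¬ m < n → (m <ᵇ n) ≡ false
<ᵇ-false {m} {n} = dec-false (m <? n)

≡ᵇ-true : ∀ {m n} → m ≡ n → (m ≡ᵇ n) ≡ true
≡ᵇ-true {m} {n} = dec-true (m ≟ n)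

≡ᵇ-false : ∀ {m n} → m ≢ n → (m ≡ᵇ n) ≡ false
≡ᵇ-false {m} {n} = dec-false (m ≟ n)

All-T⇒T-and : ∀ {bs} → All T bs → T (and bs)
All-T⇒T-and [] = _
All-T⇒T-and {true ∷ _} (_ ∷ ts) = All-T⇒T-and ts

T-and⇒All-T : ∀ {bs} → T (and bs) → All T bs
T-and⇒All-T {[]} _ = []
T-and⇒All-T {true ∷ _} t = _ ∷ T-and⇒All-T t

search-≤ : ∀ f i n → search f i n ≤ i + n
search-≤ f i zero = m≤m+n i 0
search-≤ f i (suc n) with f i
... | true = m≤m+n i (suc n)
... | false = subst (search f (suc i) n ≤_) (sym (+-suc i n)) (search-≤ f (suc i) n)

search-miss : ∀ f i n l → i ≤ l → l < search f i n → ¬ T (f l)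
search-miss f i zero l i≤l l<i = contradiction (≤-<-trans i≤l l<i) (n≮n i)
search-miss f i (suc n) l i≤l l<s with f i in fi≡
... | true = contradiction (≤-<-trans i≤l l<s) (n≮n i)
... | false with m≤n⇒m<n∨m≡n i≤l
...   | inj₁ i<l = search-miss f (suc i) n l i<l l<s
...   | inj₂ refl = subst T fi≡

search-hit : ∀ f i n → search f i n < i + n → T (f (search f i n))
search-hit f i zero i<i+0 = contradiction (subst (i <_) (+-identityʳ i) i<i+0) (n≮n i)
search-hit f i (suc n) s<i+n with f i in fi≡
... | true = subst T (sym fi≡) _
... | false = search-hit f (suc i) n (subst (search f (suc i) n <_) (+-suc i n) s<i+n)

Ascending : (ℕ → ℕ) → ℕ → ℕ → Set
Ascending f lo hi = ∀ n → lo ≤ n → suc n ≤ hi → f n < f (suc n)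

Ascending⇒< : ∀ {f lo hi x y} → Ascending f lo hi → lo ≤ x → x < y → y ≤ hi → f x < f y
Ascending⇒< {y = suc y} asc lo≤x (s≤s x≤y) y≤hi with m≤n⇒m<n∨m≡n x≤y
... | inj₂ refl = asc _ lo≤x y≤hi
... | inj₁ x<y = <-trans (Ascending⇒< asc lo≤x x<y (≤-trans (n≤1+n y) y≤hi))
                         (asc y (≤-trans lo≤x (<⇒≤ x<y)) y≤hi)

Ascending-snoc : ∀ {f lo hi} → Ascending f lo hi → f hi < f (suc hi) → Ascending f lo (suc hi)
Ascending-snoc asc last n lo≤n (s≤s n≤hi) with m≤n⇒m<n∨m≡n n≤hi
... | inj₁ n<hi = asc n lo≤n n<hi
... | inj₂ refl = last

Ascending-narrow : ∀ {f lo lo' hi} → lo ≤ lo' → Ascending f lo hi → Ascending f lo' hi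
Ascending-narrow lo≤lo' asc n lo'≤n = asc n (≤-trans lo≤lo' lo'≤n)

offset⇒Ascending : ∀ {f} h b → (∀ i → 1 ≤ i → i < h → f (i + b) < f (suc i + b)) →
  Ascending f (suc b) (h + b)
offset⇒Ascending {f} h b H n b<n sn≤h+b =
  subst (λ x → f x < f (suc x)) n∸b+b≡n (H (n ∸ b) (m<n⇒0<n∸m b<n) n∸b<h)
  where
  n∸b+b≡n : n ∸ b + b ≡ n
  n∸b+b≡n = m∸n+n≡m (<⇒≤ b<n)
  n∸b<h : n ∸ b < h
  n∸b<h = +-cancelʳ-≤ b (suc (n ∸ b)) h (subst (λ x → suc x ≤ h + b) (sym n∸b+b≡n) sn≤h+b)

Ascending⇒offset : ∀ {f} h b → Ascending f (suc b) (h + b) →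
  ∀ i → 1 ≤ i → i < h → f (i + b) < f (suc i + b)
Ascending⇒offset h b asc i 1≤i i<h = asc (i + b) (+-monoˡ-≤ b 1≤i) (+-monoˡ-≤ b i<h)

condᵇ-sound : ∀ h b v → T (condᵇ h b v) → ∀ i → 1 ≤ i → i < h → R v (i + b) < R v (suc i + b)
condᵇ-sound (suc h) b v t (suc j) _ (s≤s j<h) =
  <ᵇ⇒< _ _ (applyUpTo⁻ suc h (map⁻ (T-and⇒All-T t)) j<h)

condᵇ-complete : ∀ h b v → (∀ i → 1 ≤ i → i < h → R v (i + b) < R v (suc i + b)) →
  T (condᵇ h b v)
condᵇ-complete zero b v _ = _
condᵇ-complete (suc h) b v H =
  All-T⇒T-and (map⁺ (applyUpTo⁺₁ suc h λ j<h → <⇒<ᵇ (H _ (s≤s z≤n) (s<s j<h))))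

rowLen-antitone : ∀ {lam} → Linked (λ a b → b ≤ a) lam → ∀ i → 1 ≤ i →
  rowLen lam (suc i) ≤ rowLen lam i
rowLen-antitone [] i _ = z≤n
rowLen-antitone [-] (suc zero) _ = z≤n
rowLen-antitone [-] (suc (suc i)) _ = z≤n
rowLen-antitone (b≤a ∷ _) (suc zero) _ = b≤a
rowLen-antitone (_ ∷ decr) (suc (suc i)) _ = rowLen-antitone decr (suc i) (s≤s z≤n)

InDiagram-up : ∀ {lam i j} → Linked (λ a b → b ≤ a) lam → 1 ≤ i →
  InDiagram lam (suc i , j) → InDiagram lam (i , j)
InDiagram-up {i = i} decr 1≤i (_ , si≤ℓ , 1≤j , j≤len) =
  1≤i , <⇒≤ si≤ℓ , 1≤j , ≤-trans j≤len (rowLen-antitone decr i 1≤i)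

_⋖_ : Box → Box → Set
(i , j) ⋖ (i' , j') = (i' ≡ i × j' ≡ suc j) ⊎ (i' ≡ suc i × j' ≡ j)

⋖⇒row≤ : ∀ b b' → b ⋖ b' → proj₁ b ≤ proj₁ b'
⋖⇒row≤ _ _ (inj₁ (refl , _)) = ≤-refl
⋖⇒row≤ _ _ (inj₂ (refl , _)) = n≤1+n _

IsSYT⇒⋖-increasing : ∀ {lam k v x y} → IsSYT lam k v → InRange k x → InRange k y →
  v x ⋖ v y → x < y
IsSYT⇒⋖-increasing {v = v} {x} (_ , _ , _ , rowInc , _) rx ry (inj₁ (i≡ , j≡)) =
  rowInc _ _ _ (proj₂ (v x)) rx ry refl (cong₂ _,_ i≡ j≡)
IsSYT⇒⋖-increasing {v = v} {x} (_ , _ , _ , _ , colInc) rx ry (inj₂ (i≡ , j≡)) =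
  colInc _ _ (proj₁ (v x)) _ rx ry refl (cong₂ _,_ i≡ j≡)

max-ends-row : ∀ {lam k v} → IsSYT lam k v → 1 ≤ k → rowLen lam (R v k) ≤ proj₂ (v k)
max-ends-row {k = k} {v} (inD , _ , onto , rowInc , _) 1≤k = ≮⇒≥ λ c<len →
  let (1≤i , i≤ℓ , _) = inD k (1≤k , ≤-refl)
      (e , re , ve) = onto (R v k , suc (proj₂ (v k))) (1≤i , i≤ℓ , s≤s z≤n , c<len)
  in ≤⇒≯ (proj₂ re) (rowInc k e _ _ (1≤k , ≤-refl) re refl ve)

-- k ends its row, so it lies right of y; hence the box right of x exists, and its entry
-- lies above the entry right of y, which is at most k.
stacked-in-max-row⇒right-neighbour : ∀ {lam k v x y i j} → IsSYT lam k v →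
  Linked (λ a b → b ≤ a) lam → InRange k x → InRange k y → v x ≡ (i , j) → v y ≡ (suc i , j) →
  R v k ≡ suc i → y ≢ k → Σ ℕ λ e → InRange k e × v e ≡ (i , suc j) × x < e × e < k
stacked-in-max-row⇒right-neighbour {lam} {k} {v} {x} {y} {i} {j}
  syt@(inD , inj , onto , rowInc , colInc) decr rx ry vx vy Rk≡ y≢k =
  let (f , rf , vf) = onto (suc i , suc j) below-right
      (e , re , ve) = onto (i , suc j) (InDiagram-up decr x-row below-right)
  in e , re , ve , rowInc x e i j rx re vx ve , <-≤-trans (colInc e f i (suc j) re rf ve vf) (proj₂ rf)
  where
  rk : InRange k k
  rk = ≤-trans (proj₁ rx) (proj₂ rx) , ≤-refl
  c : ℕ
  c = proj₂ (v k)
  vk : v k ≡ (suc i , c)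
  vk = cong (_, c) Rk≡
  len≤c : rowLen lam (suc i) ≤ c
  len≤c = subst (λ r → rowLen lam r ≤ c) Rk≡ (max-ends-row {lam} syt (proj₁ rk))
  y-box : InDiagram lam (suc i , j)
  y-box = subst (InDiagram lam) vy (inD y ry)
  k-box : InDiagram lam (suc i , c)
  k-box = subst (InDiagram lam) vk (inD k rk)
  j<c : j < c
  j<c = ≤∧≢⇒< (≤-trans (proj₂ (proj₂ (proj₂ y-box))) len≤c)
               (λ j≡c → y≢k (inj y k ry rk (trans vy (trans (cong (suc i ,_) j≡c) (sym vk)))))
  below-right : InDiagram lam (suc i , suc j)
  below-right = proj₁ y-box , proj₁ (proj₂ y-box) , s≤s z≤n , ≤-trans j<c (proj₂ (proj₂ (proj₂ k-box)))
  x-row : 1 ≤ i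
  x-row = proj₁ (subst (InDiagram lam) vx (inD x rx))

record Permutation (k : ℕ) : Set where
  field
    to from : ℕ → ℕ
    to-range : ∀ {m} → InRange k m → InRange k (to m)
    from-range : ∀ {n} → InRange k n → InRange k (from n)
    from∘to : ∀ {m} → InRange k m → from (to m) ≡ m
    to∘from : ∀ {n} → InRange k n → to (from n) ≡ n

IsSYT-permute : ∀ {lam k v} → IsSYT lam k v → (π : Permutation k) →
  (let open Permutation π) →
  (∀ {m m'} → InRange k m → InRange k m' → v (to m) ⋖ v (to m') → m < m') →
  ∀ {U} → (∀ m → U m ≡ v (to m)) → IsSYT lam k U
IsSYT-permute {lam} {k} {v} (inD , inj , onto , _ , _) π ordered {U} U≗ =
  inD' , inj' , onto' , rowInc' , colInc'
  where
  open Permutation π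
  inD' : ∀ m → InRange k m → InDiagram lam (U m)
  inD' m r = subst (InDiagram lam) (sym (U≗ m)) (inD (to m) (to-range r))
  inj' : ∀ m m' → InRange k m → InRange k m' → U m ≡ U m' → m ≡ m'
  inj' m m' r r' eq = begin
    m             ≡⟨ sym (from∘to r) ⟩
    from (to m)   ≡⟨ cong from (inj _ _ (to-range r) (to-range r') (trans (sym (U≗ m)) (trans eq (U≗ m')))) ⟩
    from (to m')  ≡⟨ from∘to r' ⟩
    m'            ∎
    where open ≡-Reasoning
  onto' : ∀ b → InDiagram lam b → Σ ℕ λ m → InRange k m × U m ≡ b
  onto' b b∈ = let (n , rn , vn) = onto b b∈ in
    from n , from-range rn , trans (U≗ (from n)) (trans (cong v (to∘from rn)) vn)
  adjacent : ∀ {m m' b b'} → InRange k m → InRange k m' → U m ≡ b → U m' ≡ b' → b ⋖ b' → m < m'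
  adjacent {m} {m'} r r' Um≡ Um'≡ b⋖b' =
    ordered r r' (subst₂ _⋖_ (trans (sym Um≡) (U≗ m)) (trans (sym Um'≡) (U≗ m')) b⋖b')
  rowInc' : ∀ m m' i j → InRange k m → InRange k m' → U m ≡ (i , j) → U m' ≡ (i , suc j) → m < m'
  rowInc' _ _ _ _ r r' e e' = adjacent r r' e e' (inj₁ (refl , refl))
  colInc' : ∀ m m' i j → InRange k m → InRange k m' → U m ≡ (i , j) → U m' ≡ (suc i , j) → m < m'
  colInc' _ _ _ _ r r' e e' = adjacent r r' e e' (inj₂ (refl , refl))

module Cycle (α P k : ℕ) (0<α : 0 < α) (α≤P : α ≤ P) (P<k : P < k) where

  σ : ℕ → ℕ
  σ m = if m <ᵇ α then m else if m ≡ᵇ α then P else if m ≡ᵇ suc P then k else m ∸ 1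

  τ : ℕ → ℕ
  τ n = if n <ᵇ α then n else if n ≡ᵇ P then α else if n ≡ᵇ k then suc P else suc n

  data Source : ℕ → Set where
    fixed : ∀ {m} → m < α → Source m
    start : Source α
    jump : Source (suc P)
    shift : ∀ {n} → α ≤ n → n ≢ P → Source (suc n)

  source : ∀ m → Source m
  source m with m <? α
  ... | yes m<α = fixed m<α
  ... | no m≮α with m ≟ α
  ...   | yes refl = start
  ...   | no m≢α = above (≤∧≢⇒< (≮⇒≥ m≮α) (m≢α ∘ sym))
    where
    above : ∀ {m} → α < m → Source m
    above {suc n} (s≤s α≤n) with n ≟ P
    ... | yes refl = jump
    ... | no n≢P = shift α≤n n≢P

  data Target : ℕ → Set where
    fixed : ∀ {n} → n < α → Target n
    at-P : Target P
    at-k : Target k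
    other : ∀ {n} → α ≤ n → n ≢ P → n ≢ k → Target n

  target : ∀ n → Target n
  target n with n <? α
  ... | yes n<α = fixed n<α
  ... | no n≮α with n ≟ P
  ...   | yes refl = at-P
  ...   | no n≢P with n ≟ k
  ...     | yes refl = at-k
  ...     | no n≢k = other (≮⇒≥ n≮α) n≢P n≢k

  α<sP : α < suc P
  α<sP = s≤s α≤P

  σ-fixed : ∀ {m} → m < α → σ m ≡ m
  σ-fixed m<α rewrite <ᵇ-true m<α = refl

  σ-start : σ α ≡ P
  σ-start rewrite <ᵇ-false (n≮n α) | ≡ᵇ-true (refl {x = α}) = refl

  σ-jump : σ (suc P) ≡ k
  σ-jump rewrite <ᵇ-false (<⇒≯ α<sP) | ≡ᵇ-false (<⇒≢ α<sP ∘ sym) | ≡ᵇ-true (refl {x = suc P}) = refl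

  σ-shift : ∀ {n} → α ≤ n → n ≢ P → σ (suc n) ≡ n
  σ-shift {n} α≤n n≢P rewrite <ᵇ-false (<⇒≯ (s≤s α≤n)) | ≡ᵇ-false (<⇒≢ (s≤s α≤n) ∘ sym)
                            | ≡ᵇ-false (n≢P ∘ suc-injective) = refl

  τ-fixed : ∀ {n} → n < α → τ n ≡ n
  τ-fixed n<α rewrite <ᵇ-true n<α = refl

  τ-P : τ P ≡ α
  τ-P rewrite <ᵇ-false (≤⇒≯ α≤P) | ≡ᵇ-true (refl {x = P}) = refl

  τ-k : τ k ≡ suc P
  τ-k rewrite <ᵇ-false (≤⇒≯ (≤-trans α≤P (<⇒≤ P<k))) | ≡ᵇ-false (<⇒≢ P<k ∘ sym)
            | ≡ᵇ-true (refl {x = k}) = refl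

  τ-other : ∀ {n} → α ≤ n → n ≢ P → n ≢ k → τ n ≡ suc n
  τ-other α≤n n≢P n≢k rewrite <ᵇ-false (≤⇒≯ α≤n) | ≡ᵇ-false n≢P | ≡ᵇ-false n≢k = refl

  range-above : ∀ {n} → α ≤ n → n ≤ k → InRange k n
  range-above α≤n n≤k = ≤-trans 0<α α≤n , n≤k

  σ-range : ∀ {m} → InRange k m → InRange k (σ m)
  σ-range {m} r with source m
  ... | fixed m<α = subst (InRange k) (sym (σ-fixed m<α)) r
  ... | start = subst (InRange k) (sym σ-start) (range-above α≤P (<⇒≤ P<k))
  ... | jump = subst (InRange k) (sym σ-jump) (range-above (≤-trans α≤P (<⇒≤ P<k)) ≤-refl)
  ... | shift α≤n n≢P = subst (InRange k) (sym (σ-shift α≤n n≢P)) (range-above α≤n (<⇒≤ (proj₂ r)))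

  τ-range : ∀ {n} → InRange k n → InRange k (τ n)
  τ-range {n} r with target n
  ... | fixed n<α = subst (InRange k) (sym (τ-fixed n<α)) r
  ... | at-P = subst (InRange k) (sym τ-P) (range-above ≤-refl (≤-trans α≤P (<⇒≤ P<k)))
  ... | at-k = subst (InRange k) (sym τ-k) (range-above (<⇒≤ α<sP) P<k)
  ... | other α≤n n≢P n≢k =
    subst (InRange k) (sym (τ-other α≤n n≢P n≢k))
          (range-above (≤-trans α≤n (n≤1+n n)) (≤∧≢⇒< (proj₂ r) n≢k))

  τ∘σ : ∀ {m} → InRange k m → τ (σ m) ≡ m
  τ∘σ {m} r with source m
  ... | fixed m<α = trans (cong τ (σ-fixed m<α)) (τ-fixed m<α)
  ... | start = trans (cong τ σ-start) τ-P
  ... | jump = trans (cong τ σ-jump) τ-k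
  ... | shift α≤n n≢P = trans (cong τ (σ-shift α≤n n≢P)) (τ-other α≤n n≢P (<⇒≢ (proj₂ r)))

  σ∘τ : ∀ {n} → InRange k n → σ (τ n) ≡ n
  σ∘τ {n} _ with target n
  ... | fixed n<α = trans (cong σ (τ-fixed n<α)) (σ-fixed n<α)
  ... | at-P = trans (cong σ τ-P) σ-start
  ... | at-k = trans (cong σ τ-k) σ-jump
  ... | other α≤n n≢P n≢k = trans (cong σ (τ-other α≤n n≢P n≢k)) (σ-shift α≤n n≢P)

  permutation : Permutation k
  permutation = record
    { to = σ ; from = τ ; to-range = σ-range ; from-range = τ-range ; from∘to = τ∘σ ; to∘from = σ∘τ }

  σ-inversion : ∀ {m m'} → m' ≤ m → σ m < σ m' →
    (σ m' ≡ P × α ≤ σ m × σ m < P) ⊎ (σ m' ≡ k × P < σ m × σ m < k)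
  σ-inversion {m} {m'} m'≤m lt with source m' | source m
  ... | fixed m'<α | fixed m<α = contradiction (subst₂ _<_ (σ-fixed m<α) (σ-fixed m'<α) lt) (≤⇒≯ m'≤m)
  ... | fixed m'<α | start =
    contradiction (<-≤-trans m'<α α≤P) (<⇒≯ (subst₂ _<_ σ-start (σ-fixed m'<α) lt))
  ... | fixed m'<α | jump =
    contradiction (<-trans m'<α (<-≤-trans α<sP P<k)) (<⇒≯ (subst₂ _<_ σ-jump (σ-fixed m'<α) lt))
  ... | fixed m'<α | shift α≤n n≢P =
    contradiction (<-≤-trans m'<α α≤n) (<⇒≯ (subst₂ _<_ (σ-shift α≤n n≢P) (σ-fixed m'<α) lt))
  ... | start | fixed m<α = contradiction m'≤m (<⇒≱ m<α)
  ... | start | start = contradiction lt (n≮n _)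
  ... | start | jump = contradiction (subst₂ _<_ σ-jump σ-start lt) (<⇒≯ P<k)
  ... | start | shift α≤n n≢P =
    inj₁ (σ-start , subst (α ≤_) (sym (σ-shift α≤n n≢P)) α≤n , subst (σ m <_) σ-start lt)
  ... | jump | fixed m<α = contradiction (<-trans m<α α<sP) (≤⇒≯ m'≤m)
  ... | jump | start = contradiction α<sP (≤⇒≯ m'≤m)
  ... | jump | jump = contradiction lt (n≮n _)
  ... | jump | shift α≤n n≢P =
    inj₂ (σ-jump , subst (P <_) (sym (σ-shift α≤n n≢P)) (≤∧≢⇒< (≤-pred m'≤m) (n≢P ∘ sym))
         , subst (σ m <_) σ-jump lt)
  ... | shift α≤n' _ | fixed m<α = contradiction (<-≤-trans m<α (≤-trans α≤n' (n≤1+n _))) (≤⇒≯ m'≤m)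
  ... | shift α≤n' _ | start = contradiction (s≤s α≤n') (≤⇒≯ m'≤m)
  ... | shift α≤n' n'≢P | jump =
    contradiction (subst₂ _<_ σ-jump (σ-shift α≤n' n'≢P) lt) (<⇒≯ (≤-<-trans (≤-pred m'≤m) P<k))
  ... | shift α≤n' n'≢P | shift α≤n n≢P =
    contradiction (subst₂ _<_ (σ-shift α≤n n≢P) (σ-shift α≤n' n'≢P) lt) (≤⇒≯ (≤-pred m'≤m))

module Rearrangement {lam : List ℕ} (decr : Linked (λ a b → b ≤ a) lam) {v : Tableau} {α P m : ℕ}
  (0<α : 0 < α) (α≤P : α ≤ P) (P≤m : P ≤ m) (syt : IsSYT lam (suc m) v)
  (asc : Ascending (R v) α m) (k≤P : R v (suc m) ≤ R v P)
  (before-P : ∀ n → α ≤ n → n < P → R v n < R v (suc m)) where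

  k : ℕ
  k = suc m

  P<k : P < k
  P<k = s≤s P≤m

  open Cycle α P k 0<α α≤P P<k public

  chain : ∀ {x y} → α ≤ x → x < y → y ≤ m → R v x < R v y
  chain = Ascending⇒< asc

  not-adjacent-to-k : ∀ {n} → P < n → n < k → ¬ (v n ⋖ v k)
  not-adjacent-to-k {n} P<n n<k n⋖k =
    ≤⇒≯ (≤-trans (⋖⇒row≤ (v n) (v k) n⋖k) k≤P) (chain α≤P P<n (≤-pred n<k))

  not-stacked-on-P : ∀ {n i j} → α ≤ n → suc n ≡ P → v n ≡ (i , j) → ¬ (v P ≡ (suc i , j))
  not-stacked-on-P {n} {i} {j} α≤n sn≡P vn vP =
    let (e , _ , ve , n<e , e<k) =
          stacked-in-max-row⇒right-neighbour {lam} syt decr rn rP vn vP Rk≡ (<⇒≢ P<k)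
    in <-asym (chain α≤P (P<right ve n<e) (≤-pred e<k)) (right-above-P ve)
    where
    rn : InRange k n
    rn = range-above α≤n (≤-trans (n≤1+n n) (subst (_≤ k) (sym sn≡P) (<⇒≤ P<k)))
    rP : InRange k P
    rP = range-above α≤P (<⇒≤ P<k)
    Rk≡ : R v k ≡ suc i
    Rk≡ = ≤-antisym (subst (R v k ≤_) (cong proj₁ vP) k≤P)
                    (subst (_< R v k) (cong proj₁ vn) (before-P n α≤n (subst (n <_) sn≡P (n<1+n n))))
    P<right : ∀ {e} → v e ≡ (i , suc j) → n < e → P < e
    P<right {e} ve n<e = ≤∧≢⇒< (subst (_≤ e) sn≡P n<e)
      (λ P≡e → 1+n≢n (cong proj₁ (trans (trans (sym vP) (cong v P≡e)) ve)))
    right-above-P : ∀ {e} → v e ≡ (i , suc j) → R v e < R v P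
    right-above-P ve = subst₂ _<_ (sym (cong proj₁ ve)) (sym (cong proj₁ vP)) (n<1+n i)

  not-adjacent-to-P : ∀ {n} → α ≤ n → n < P → ¬ (v n ⋖ v P)
  not-adjacent-to-P {n} α≤n n<P (inj₁ (same-row , _)) = <⇒≢ (chain α≤n n<P P≤m) (sym same-row)
  not-adjacent-to-P {n} α≤n n<P (inj₂ (next-row , same-col)) with m≤n⇒m<n∨m≡n n<P
  ... | inj₂ sn≡P = not-stacked-on-P α≤n sn≡P refl (cong₂ _,_ next-row same-col)
  ... | inj₁ sn<P = <-irrefl (sym next-row)
    (≤-trans (s≤s (chain α≤n (n<1+n n) (≤-trans (<⇒≤ sn<P) P≤m)))
             (chain (≤-trans α≤n (n≤1+n n)) sn<P P≤m))

  σ-⋖-ordered : ∀ {j j'} → InRange k j → InRange k j' → v (σ j) ⋖ v (σ j') → j < j'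
  σ-⋖-ordered {j} {j'} r r' adj with j <? j'
  ... | yes j<j' = j<j'
  ... | no j≮j' with σ-inversion (≮⇒≥ j≮j') (IsSYT⇒⋖-increasing {lam} syt (σ-range r) (σ-range r') adj)
  ...   | inj₁ (σj'≡P , α≤σj , σj<P) =
    contradiction (subst (λ x → v (σ j) ⋖ v x) σj'≡P adj) (not-adjacent-to-P α≤σj σj<P)
  ...   | inj₂ (σj'≡k , P<σj , σj<k) =
    contradiction (subst (λ x → v (σ j) ⋖ v x) σj'≡k adj) (not-adjacent-to-k P<σj σj<k)

  rearranged-SYT : ∀ {U} → (∀ j → U j ≡ v (σ j)) → IsSYT lam k U
  rearranged-SYT = IsSYT-permute {lam} syt permutation σ-⋖-ordered

  rearranged-ascending : Ascending (R v ∘ σ) (suc α) k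
  rearranged-ascending (suc n) (s≤s α≤n) (s≤s sn≤m) with <-cmp n P
  ... | tri≈ _ refl _ rewrite σ-jump | σ-shift (≤-trans α≤P (n≤1+n P)) (1+n≢n {P}) =
    ≤-<-trans k≤P (asc P α≤P sn≤m)
  ... | tri> _ _ P<n rewrite σ-shift α≤n (<⇒≢ P<n ∘ sym)
                           | σ-shift (≤-trans α≤n (n≤1+n n)) (<⇒≢ (<-trans P<n (n<1+n n)) ∘ sym) =
    asc n α≤n sn≤m
  ... | tri< n<P _ _ with m≤n⇒m<n∨m≡n n<P
  ...   | inj₁ sn<P rewrite σ-shift α≤n (<⇒≢ n<P) | σ-shift (≤-trans α≤n (n≤1+n n)) (<⇒≢ sn<P) =
    asc n α≤n sn≤m
  ...   | inj₂ refl rewrite σ-shift α≤n (<⇒≢ n<P) | σ-jump = before-P n α≤n n<P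

pIdx-least : ∀ h α v → R v (suc h + α) ≤ R v (h + α) →
  let p = pIdx (suc h) α v in
  p < suc h × R v (suc h + α) ≤ R v (p + α) × (∀ n → α ≤ n → n < p + α → R v n < R v (suc h + α))
pIdx-least h α v last = p<sh , ≤ᵇ⇒≤ _ _ (search-hit f 0 (suc h) p<sh) , before
  where
  f : ℕ → Bool
  f i = R v (suc h + α) ≤ᵇ R v (i + α)
  p : ℕ
  p = pIdx (suc h) α v
  p<sh : p < suc h
  p<sh with m≤n⇒m<n∨m≡n (search-≤ f 0 (suc h))
  ... | inj₁ p<sh = p<sh
  ... | inj₂ p≡sh =
    contradiction (≤⇒≤ᵇ last) (search-miss f 0 (suc h) h z≤n (subst (h <_) (sym p≡sh) (n<1+n h)))
  before : ∀ n → α ≤ n → n < p + α → R v n < R v (suc h + α)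
  before n α≤n n<P =
    subst (λ x → R v x < R v (suc h + α)) n∸α+α≡n
          (≰⇒> (search-miss f 0 (suc h) (n ∸ α) z≤n n∸α<p ∘ ≤⇒≤ᵇ))
    where
    n∸α+α≡n : n ∸ α + α ≡ n
    n∸α+α≡n = m∸n+n≡m α≤n
    n∸α<p : n ∸ α < p
    n∸α<p = +-cancelʳ-< α (n ∸ α) p (subst (_< p + α) (sym n∸α+α≡n) n<P)

moved-SYT : ∀ h α lam → Linked (λ a b → b ≤ a) lam → 0 < α → ∀ v → IsSYT lam (suc h + α) v →
  Ascending (R v) α (h + α) → R v (suc h + α) ≤ R v (h + α) →
  SYT[ suc h , α ] lam (suc h + α) (moved (suc h) α v)
moved-SYT h α lam decr 0<α v syt asc last with (p<sh , k≤P , before-P) ← pIdx-least h α v last =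
  rearranged-SYT moved≗ , Ascending⇒offset (suc h) α moved-ascending
  where
  open Rearrangement decr 0<α (m≤n+m α (pIdx (suc h) α v)) (+-monoˡ-≤ α (≤-pred p<sh))
                     syt asc k≤P before-P
  moved≗ : ∀ j → moved (suc h) α v j ≡ v (σ j)
  moved≗ j with j <ᵇ α | j ≡ᵇ α | j ≡ᵇ suc (pIdx (suc h) α v + α)
  ... | true | _ | _ = refl
  ... | false | true | _ = refl
  ... | false | false | true = refl
  ... | false | false | false = refl
  moved-ascending : Ascending (R (moved (suc h) α v)) (suc α) (suc h + α)
  moved-ascending n α<n sn≤k rewrite moved≗ n | moved≗ (suc n) = rearranged-ascending n α<n sn≤k

proposition4p5 : (h α : ℕ) → 0 < h → 0 < α → (lam : List ℕ) → lam ⊢ (h + α) →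
    (T : Tableau) → SYT[ h , α ∸ 1 ] lam (h + α) T →
    SYT[ h , α ] lam (h + α) (φ h α T)
proposition4p5 (suc h) (suc a) _ 0<α lam (decr , _) v (syt , hyp) with condᵇ (suc h) (suc a) v in cond
... | true = syt , condᵇ-sound (suc h) (suc a) v (subst T (sym cond) _)
... | false = moved-SYT h (suc a) lam decr 0<α v syt asc last
  where
  asc : Ascending (R v) (suc a) (h + suc a)
  asc = subst (Ascending (R v) (suc a)) (sym (+-suc h a)) (offset⇒Ascending (suc h) a hyp)
  last : R v (suc h + suc a) ≤ R v (h + suc a)
  last = ≮⇒≥ λ lt → subst T cond (condᵇ-complete (suc h) (suc a) v
    (Ascending⇒offset (suc h) (suc a) (Ascending-narrow (n≤1+n (suc a)) (Ascending-snoc asc lt))))
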